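{- Let $c$ be a generator of $(\mathbb{Z}/p\mathbb{Z})^\times$ and $\sigma_p\in\mathrm{Gal}(\mathbb{Q}(\zeta)/\mathbb{Q})$ the automorphism with $\sigma_p(\zeta^q)=\zeta^{qc}$ and $\sigma_p(\zeta^p)=\zeta^{p}$. For $1\le i\le g$ let $s_i=\langle c(a_i+1)\rangle_p-1$, $b_i'=q-b_i$, $\iota_1=\kappa_{b_i-1}+s_i+1$ and $\iota_2=\kappa_{b_i'-1}+p-(s_i+1)$. Then ${}^{\sigma_p}\alpha$ (obtained by applying $\sigma_p$ to every entry of $\alpha$) is the block diagonal matrix whose $i$-th diagonal $2\times2$ block is $\alpha[\iota_1]$ if $0\le s_i\le k_{b_i}$, is $\overline{\alpha[\iota_2]}$ if $s_i>k_{b_i}$, and is $0$ otherwise.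
   Context: Let $p\neq q$ be odd primes and $g=(p-1)(q-1)/2$. Let $\zeta=e^{2\pi i/(pq)}$ and $Z=\mathrm{diag}(\zeta,\overline{\zeta})$. Notation: $\langle x\rangle_r$ is the representative of $x$ mod $r$ in $\{0,\dots,r-1\}$. For $1\le b\le q-1$ let $k_b=\lfloor (pb-q-1)/q\rfloor$; for $0\le t\le q-1$ let $\kappa_t=\sum_{1\le b\le t,\ k_b\ge0}(k_b+1)$ (so $\kappa_0=0$). The integer pairs $(a,b)$ with $1\le b\le q-1$, $0\le a\le k_b$ are exactly $g$ in number; order them by increasing $b$ then increasing $a$, and let $(a_i,b_i)$ be the $i$-th pair, so that the pair $(a,b)$ has index $\kappa_{b-1}+a+1$. Let $\alpha$ be the $2g\times2g$ block diagonal matrix whose $i$-th diagonal $2\times 2$ block is $\alpha[i]=Z^{q(a_i+1)-pb_i}$ (the matrix of the endomorphism of $\mathrm{Jac}(C_{p,q})$, $C_{p,q}:y^q=x^p-1$, induced by $(x,y)\mapsto(\zeta^q x,\zeta^p y)$). $\overline{X}$ denotes entrywise complex conjugation. -}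

module Defs where

open import Data.Nat as ℕ using (ℕ; zero; suc; NonZero)
open import Data.Nat.DivMod as ℕD using (_%_; _/_; _mod_)
open import Data.Integer as ℤ using (ℤ; +_; ∣_∣; 0ℤ)
open import Data.Integer.DivMod using (_/ℕ_)
open import Data.Integer.Divisibility as ℤDiv using ()
open import Data.Fin using (Fin; zero; suc)
open import Data.List using (List; []; _∷_; map; upTo; concatMap)
open import Data.Nat.ListAction using (sum)
open import Data.Product using (_×_; _,_; proj₁; proj₂; ∃)
open import Data.Bool using (if_then_else_)
open import Relation.Nullary using (does)
open import Relation.Binary.PropositionalEquality using (_≡_)

-- Every entry of α (and of its Galois conjugates and
-- complex conjugates) is either 0 or a power of ζ = e^{2πi/(pq)}.
-- We model such an entry as 𝟘 or ζ^ e with e ∈ ℤ; equality of entries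
-- is equality in ℂ, i.e. ζ^a = ζ^b iff pq ∣ a - b.

data Ent : Set where
  𝟘  : Ent
  ζ^ : ℤ → Ent

EntEq : ℕ → Ent → Ent → Set
EntEq N 𝟘      𝟘      = Data.Unit.⊤ where import Data.Unit
EntEq N 𝟘      (ζ^ b) = Data.Empty.⊥ where import Data.Empty
EntEq N (ζ^ a) 𝟘      = Data.Empty.⊥ where import Data.Empty
EntEq N (ζ^ a) (ζ^ b) = (+ N) ℤDiv.∣ (a ℤ.- b)

conjE : Ent → Ent
conjE 𝟘      = 𝟘
conjE (ζ^ a) = ζ^ (ℤ.- a)

σE : ℕ → Ent → Ent
σE u 𝟘      = 𝟘
σE u (ζ^ a) = ζ^ ((+ u) ℤ.* a)

Mat2 : Set
Mat2 = Fin 2 → Fin 2 → Ent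

Zpow : ℤ → Mat2
Zpow n zero       zero       = ζ^ n
Zpow n (suc zero) (suc zero) = ζ^ (ℤ.- n)
Zpow n _          _          = 𝟘

conjM2 : Mat2 → Mat2
conjM2 M i j = conjE (M i j)

zeroM2 : Mat2
zeroM2 _ _ = 𝟘

-- square matrices with 0-based ℕ indices (only entries with indices < size matter)
Mat : Set
Mat = ℕ → ℕ → Ent

-- block diagonal matrix whose i-th (1-based) diagonal 2×2 block is B i
blockDiag : (ℕ → Mat2) → Mat
blockDiag B r s =
  if does (r / 2 ℕ.≟ s / 2) then B (suc (r / 2)) (r mod 2) (s mod 2) else 𝟘

σMat : ℕ → Mat → Mat
σMat u M r s = σE u (M r s)

MatEq : ℕ → ℕ → Mat → Mat → Set
MatEq N n M M' = ∀ r s → r ℕ.< n → s ℕ.< n → EntEq N (M r s) (M' r s)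

genus : ℕ → ℕ → ℕ
genus p q = (p ℕ.∸ 1) ℕ.* (q ℕ.∸ 1) / 2

kk : (p q : ℕ) .{{_ : NonZero q}} → ℕ → ℤ
kk p q b = ((+ (p ℕ.* b)) ℤ.- (+ (q ℕ.+ 1))) /ℕ q

pairsFor : (p q : ℕ) .{{_ : NonZero q}} → ℕ → List (ℕ × ℕ)
pairsFor p q b =
  if does (0ℤ ℤ.≤? kk p q b) then map (λ a → (a , b)) (upTo (suc ∣ kk p q b ∣)) else []

pairs : (p q : ℕ) .{{_ : NonZero q}} → List (ℕ × ℕ)
pairs p q = concatMap (pairsFor p q) (map suc (upTo (q ℕ.∸ 1)))

κ : (p q : ℕ) .{{_ : NonZero q}} → ℕ → ℕ
κ p q t = sum (map term (map suc (upTo t)))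
  where
  term : ℕ → ℕ
  term b = if does (0ℤ ℤ.≤? kk p q b) then suc ∣ kk p q b ∣ else 0

nth : {A : Set} → List A → ℕ → A → A
nth []       _       d = d
nth (x ∷ xs) zero    d = x
nth (x ∷ xs) (suc n) d = nth xs n d

-- the i-th pair (a_i, b_i), 1-based
pairAt : (p q : ℕ) .{{_ : NonZero q}} → ℕ → ℕ × ℕ
pairAt p q i = nth (pairs p q) (i ℕ.∸ 1) (0 , 0)

aIdx bIdx : (p q : ℕ) .{{_ : NonZero q}} → ℕ → ℕ
aIdx p q i = proj₁ (pairAt p q i)
bIdx p q i = proj₂ (pairAt p q i)

αBlock : (p q : ℕ) .{{_ : NonZero q}} → ℕ → Mat2
αBlock p q i = Zpow ((+ (q ℕ.* suc (aIdx p q i))) ℤ.- (+ (p ℕ.* bIdx p q i)))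

α : (p q : ℕ) .{{_ : NonZero q}} → Mat
α p q = blockDiag (αBlock p q)

IsGenerator : (p : ℕ) .{{_ : NonZero p}} → ℕ → Set
IsGenerator p c = ∀ x → 1 ℕ.≤ x → x ℕ.< p → ∃ λ n → (c ℕ.^ n) % p ≡ x

sIdx : (p q : ℕ) .{{_ : NonZero p}} .{{_ : NonZero q}} → ℕ → ℕ → ℤ
sIdx p q c i = (+ ((c ℕ.* suc (aIdx p q i)) % p)) ℤ.- (+ 1)

ι₁ : (p q : ℕ) .{{_ : NonZero p}} .{{_ : NonZero q}} → ℕ → ℕ → ℤ
ι₁ p q c i = (+ κ p q (bIdx p q i ℕ.∸ 1)) ℤ.+ sIdx p q c i ℤ.+ (+ 1)

ι₂ : (p q : ℕ) .{{_ : NonZero p}} .{{_ : NonZero q}} → ℕ → ℕ → ℤ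
ι₂ p q c i = (+ κ p q ((q ℕ.∸ bIdx p q i) ℕ.∸ 1)) ℤ.+ (+ p) ℤ.- (sIdx p q c i ℤ.+ (+ 1))

βBlock : (p q : ℕ) .{{_ : NonZero p}} .{{_ : NonZero q}} → ℕ → ℕ → Mat2
βBlock p q c i =
  if does (0ℤ ℤ.≤? s) then
    (if does (s ℤ.≤? kb) then αBlock p q ∣ ι₁ p q c i ∣
     else conjM2 (αBlock p q ∣ ι₂ p q c i ∣))
  else
    (if does (kb ℤ.<? s) then conjM2 (αBlock p q ∣ ι₂ p q c i ∣) else zeroM2)
  where
  s  = sIdx p q c i
  kb = kk p q (bIdx p q i)

β : (p q : ℕ) .{{_ : NonZero p}} .{{_ : NonZero q}} → ℕ → Mat
β p q c = blockDiag (βBlock p q c)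

-- Write e(a, b) = q(a+1) - pb, so that the block α[i] of the pair (a, b) is Z^e(a,b). Since σ_p fixes
-- ζ^p and sends ζ^q to ζ^(qc), it sends Z^e(a,b) to Z^e(s,b), where s + 1 = ⟨c(a+1)⟩_p.
-- As q ∤ pb we have k_b = ⌊pb/q⌋ - 1, so the ⌊pb/q⌋ pairs with second entry b occupy the positions
-- κ_{b-1} + 1, …, κ_b, and ⌊pb/q⌋ + ⌊p(q-b)/q⌋ = p - 1. If s ≤ k_b then (s, b) is itself a pair, at
-- position ι₁. Otherwise the complementary pair (p - 2 - s, q - b) exists, sits at position ι₂ and has
-- exponent -e(s, b), so its conjugated block is Z^e(s,b). Summing the complementarity over b gives
-- 2 κ_{q-1} = (p-1)(q-1), i.e. κ_{q-1} = g, which bounds all positions by g.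

module Submission where

open import Defs
open import Function using (_∘_)
open import Data.Bool using (true; false; if_then_else_)
open import Data.Empty using (⊥-elim)
open import Data.Fin using (zero; suc)
open import Data.Integer as ℤ using (ℤ; +_; -[1+_]; ∣_∣; 0ℤ; _⊖_; +≤+; +<+)
import Data.Integer.Properties as ℤP
import Data.Integer.Divisibility as ℤᵘ
open import Data.Integer.Divisibility.Signed
  using (∣ᵤ⇒∣; ∣⇒∣ᵤ; ∣-refl; ∣m⇒∣-m; ∣m∣n⇒∣m+n; ∣m∣n⇒∣m-n; ∣n⇒∣m*n) renaming (_∣_ to _∣ℤ_)
open import Data.Integer.DivMod using (_/ℕ_)
open import Data.Integer.Tactic.RingSolver as ℤ-Solver using ()
open import Data.List using (List; []; _∷_; _++_; _∷ʳ_; map; upTo; applyUpTo; concat; concatMap; length)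
open import Data.List.Properties
  using (map-++; concat-++; length-++; length-map; length-upTo; map-upTo; applyUpTo-∷ʳ; ++-identityʳ)
open import Data.Nat as ℕ
  using (ℕ; zero; suc; NonZero; _+_; _*_; _∸_; _≤_; _<_; z≤n; s≤s; _/_; _%_; _^_;
         nonTrivial⇒≢1; nonTrivial⇒n>1; >-nonZero)
open import Data.Nat.DivMod
open import Data.Nat.Divisibility using (_∣_; divides; m%n≡0⇒n∣m; n∣m⇒m%n≡0; ∣⇒≤; ∣-trans; m∣m*n)
open import Data.Nat.ListAction using (sum)
open import Data.Nat.ListAction.Properties using (sum-++)
open import Data.Nat.Primality using (Prime; euclidsLemma; prime⇒irreducible; prime⇒nonTrivial)
open import Data.Nat.Properties
open import Algebra.Properties.CommutativeSemigroup +-commutativeSemigroup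
  using () renaming (interchange to +-interchange)
open import Data.Nat.Tactic.RingSolver using (solve-∀)
open import Data.Product using (_×_; _,_; proj₁; proj₂; ∃₂)
open import Data.Sum using (inj₁; inj₂)
open import Data.Unit using (tt)
open import Relation.Binary.PropositionalEquality
open import Relation.Nullary using (¬_; yes; no; does)
open import Relation.Nullary.Decidable using (dec-true; dec-false)

nth-++ˡ : ∀ {A : Set} (xs ys : List A) {j} (d : A) → j < length xs → nth (xs ++ ys) j d ≡ nth xs j d
nth-++ˡ (x ∷ xs) ys {zero}  d _         = refl
nth-++ˡ (x ∷ xs) ys {suc j} d (s≤s j<n) = nth-++ˡ xs ys d j<n

nth-++ʳ : ∀ {A : Set} (xs ys : List A) j (d : A) → nth (xs ++ ys) (length xs + j) d ≡ nth ys j d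
nth-++ʳ []       ys j d = refl
nth-++ʳ (x ∷ xs) ys j d = nth-++ʳ xs ys j d

nth-applyUpTo : ∀ {A : Set} (f : ℕ → A) {n j} (d : A) → j < n → nth (applyUpTo f n) j d ≡ f j
nth-applyUpTo f {suc n} {zero}  d _         = refl
nth-applyUpTo f {suc n} {suc j} d (s≤s j<n) = nth-applyUpTo (f ∘ suc) d j<n

∑ : ℕ → (ℕ → ℕ) → ℕ
∑ zero    f = 0
∑ (suc n) f = ∑ n f + f (suc n)

∑-cong : ∀ n {f g : ℕ → ℕ} → (∀ b → 1 ≤ b → b ≤ n → f b ≡ g b) → ∑ n f ≡ ∑ n g
∑-cong zero    f≗g = refl
∑-cong (suc n) f≗g =
  cong₂ _+_ (∑-cong n (λ b 1≤b b≤n → f≗g b 1≤b (m≤n⇒m≤1+n b≤n))) (f≗g (suc n) (s≤s z≤n) ≤-refl)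

∑-+ : ∀ n (f g : ℕ → ℕ) → ∑ n (λ b → f b + g b) ≡ ∑ n f + ∑ n g
∑-+ zero    f g = refl
∑-+ (suc n) f g = begin
  ∑ n (λ b → f b + g b) + (fₙ + gₙ)  ≡⟨ cong (_+ (fₙ + gₙ)) (∑-+ n f g) ⟩
  (∑ n f + ∑ n g) + (fₙ + gₙ)        ≡⟨ +-interchange (∑ n f) (∑ n g) fₙ gₙ ⟩
  (∑ n f + fₙ) + (∑ n g + gₙ)        ∎
  where
  open ≡-Reasoning
  fₙ = f (suc n)
  gₙ = g (suc n)

∑-const : ∀ n k → ∑ n (λ _ → k) ≡ n * k
∑-const zero    k = refl
∑-const (suc n) k = trans (cong (_+ k) (∑-const n k)) (+-comm (n * k) k)

∑-shift : ∀ n f → ∑ (suc n) f ≡ f 1 + ∑ n (f ∘ suc)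
∑-shift zero    f = sym (+-identityʳ (f 1))
∑-shift (suc n) f = trans (cong (_+ f (2 + n)) (∑-shift n f)) (+-assoc (f 1) _ _)

∑-reflect : ∀ n f → ∑ n f ≡ ∑ n (λ b → f (suc n ∸ b))
∑-reflect zero    f = refl
∑-reflect (suc n) f = begin
  ∑ n f + f (suc n)                      ≡⟨ cong (_+ f (suc n)) (∑-reflect n f) ⟩
  ∑ n (λ b → f (suc n ∸ b)) + f (suc n)  ≡⟨ +-comm _ (f (suc n)) ⟩
  f (suc n) + ∑ n (λ b → f (suc n ∸ b))  ≡⟨ ∑-shift n (λ b → f (2 + n ∸ b)) ⟨
  ∑ (suc n) (λ b → f (2 + n ∸ b))        ∎
  where open ≡-Reasoning

∑-pairing : ∀ n f k → (∀ b → 1 ≤ b → b ≤ n → f b + f (suc n ∸ b) ≡ k) → ∑ n f * 2 ≡ n * k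
∑-pairing n f k pairs = begin
  ∑ n f * 2                                ≡⟨ *-comm (∑ n f) 2 ⟩
  ∑ n f + (∑ n f + 0)                      ≡⟨ cong (_+_ (∑ n f)) (+-identityʳ (∑ n f)) ⟩
  ∑ n f + ∑ n f                            ≡⟨ cong (_+_ (∑ n f)) (∑-reflect n f) ⟩
  ∑ n f + ∑ n (λ b → f (suc n ∸ b))        ≡⟨ ∑-+ n f (λ b → f (suc n ∸ b)) ⟨
  ∑ n (λ b → f b + f (suc n ∸ b))          ≡⟨ ∑-cong n pairs ⟩
  ∑ n (λ _ → k)                            ≡⟨ ∑-const n k ⟩
  n * k                                    ∎
  where open ≡-Reasoning

m≡r+k*n⇒m/n≡k : ∀ {m r k} n .{{_ : NonZero n}} → m ≡ r + k * n → r < n → m / n ≡ k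
m≡r+k*n⇒m/n≡k {m} {r} {k} n m≡r+kn r<n = begin
  m / n               ≡⟨ /-congˡ m≡r+kn ⟩
  (r + k * n) / n     ≡⟨ +-distrib-/-∣ʳ r (divides k refl) ⟩
  r / n + k * n / n   ≡⟨ cong₂ _+_ (m<n⇒m/n≡0 r<n) (m*n/n≡m k n) ⟩
  k                   ∎
  where open ≡-Reasoning

-[1+m]/ℕn≡-1 : ∀ {m} n .{{_ : NonZero n}} → m < n → -[1+ m ] /ℕ n ≡ -[1+ 0 ]
-[1+m]/ℕn≡-1 {m} n m<n with suc m % n in eq | m≤n⇒m<n∨m≡n m<n
... | zero  | inj₁ 1+m<n = ⊥-elim (1+n≢0 (trans (sym (m<n⇒m%n≡m 1+m<n)) eq))
... | zero  | inj₂ refl  = cong (ℤ.-_ ∘ +_) (n/n≡1 n)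
... | suc _ | inj₁ 1+m<n = cong -[1+_] (m<n⇒m/n≡0 1+m<n)
... | suc _ | inj₂ refl  = ⊥-elim (1+n≢0 (trans (sym eq) (n%n≡0 n)))

[m-n-1]/ℕn≡m/n-1 : ∀ m n .{{_ : NonZero n}} → m % n ≢ 0 → (+ m ℤ.- + (n + 1)) /ℕ n ≡ ℤ.pred (+ (m / n))
[m-n-1]/ℕn≡m/n-1 m n m%n≢0 with m % n in r≡ | m / n in k≡ | m≡m%n+[m/n]*n m n | m%n<n m n
... | zero   | _     | _   | _   = ⊥-elim (m%n≢0 refl)
... | suc r' | zero  | m≡r | r<n = begin
  (+ m ℤ.- + (n + 1)) /ℕ n      ≡⟨ cong (λ x → (+ x ℤ.- + (n + 1)) /ℕ n) (trans m≡r (+-identityʳ _)) ⟩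
  (+ suc r' ℤ.- + (n + 1)) /ℕ n ≡⟨ cong (λ x → (+ suc r' ℤ.- + x) /ℕ n) (+-comm n 1) ⟩
  (suc r' ⊖ suc n) /ℕ n         ≡⟨ cong (_/ℕ n) (ℤP.⊖-≤ (m≤n⇒m≤1+n (<⇒≤ r<n))) ⟩
  ℤ.- + (n ∸ r') /ℕ n           ≡⟨ cong (λ x → ℤ.- + x /ℕ n) (+-∸-assoc 1 (<⇒≤ r<n)) ⟩
  -[1+ n ∸ suc r' ] /ℕ n        ≡⟨ -[1+m]/ℕn≡-1 n (∸-monoʳ-< (s≤s z≤n) (<⇒≤ r<n)) ⟩
  -[1+ 0 ]                      ∎
  where open ≡-Reasoning
... | suc r' | suc k | m≡r | r<n = begin
  (+ m ℤ.- + (n + 1)) /ℕ n      ≡⟨ cong (λ x → (+ m ℤ.- + x) /ℕ n) (+-comm n 1) ⟩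
  (m ⊖ suc n) /ℕ n              ≡⟨ cong (_/ℕ n) (ℤP.⊖-≥ n<m) ⟩
  + ((m ∸ suc n) / n)           ≡⟨ cong +_ (m≡r+k*n⇒m/n≡k n m-n-1≡ (<⇒≤ r<n)) ⟩
  + k                           ∎
  where
  open ≡-Reasoning
  rearrange : ∀ r k n → suc r + suc k * n ≡ suc n + (r + k * n)
  rearrange = solve-∀
  m≡ : m ≡ suc n + (r' + k * n)
  m≡ = trans m≡r (rearrange r' k n)
  n<m : suc n ≤ m
  n<m = subst (suc n ≤_) (sym m≡) (m≤m+n _ _)
  m-n-1≡ : m ∸ suc n ≡ r' + k * n
  m-n-1≡ = trans (cong (_∸ suc n) m≡) (m+n∸m≡n (suc n) _)

-- The remainders of m and of m' add up to n, so their quotients add up to k - 1.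
m/n+m'/n≡k-1 : ∀ m m' k n .{{_ : NonZero n}} → m % n ≢ 0 → m + m' ≡ k * n → m / n + m' / n ≡ k ∸ 1
m/n+m'/n≡k-1 m m' k n m%n≢0 m+m'≡kn with m % n in r≡ | m≡m%n+[m/n]*n m n | m%n<n m n
... | zero   | _   | _   = ⊥-elim (m%n≢0 refl)
... | suc r' | m≡r | r<n = begin
  Q + m' / n  ≡⟨ cong (_+_ Q) (m≡r+k*n⇒m/n≡k n m'≡t+jn t<n) ⟩
  Q + j       ≡⟨ cong (_∸ 1) k≡ ⟨
  k ∸ 1       ∎
  where
  open ≡-Reasoning
  Q = m / n
  R = suc r'
  Q<k : Q < k
  Q<k = *-cancelʳ-< n Q k (<-≤-trans Qn<m (subst (m ≤_) m+m'≡kn (m≤m+n m m')))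
    where
    Qn<m : Q * n < m
    Qn<m = subst (Q * n <_) (sym m≡r) (m<n+m (Q * n) (s≤s z≤n))
  j = k ∸ suc Q
  k≡ : k ≡ suc Q + j
  k≡ = sym (m+[n∸m]≡n Q<k)
  t = n ∸ R
  n≡ : n ≡ R + t
  n≡ = sym (m+[n∸m]≡n (<⇒≤ r<n))
  t<n : t < n
  t<n = ∸-monoʳ-< (s≤s z≤n) (<⇒≤ r<n)
  expand : ∀ R t Q j → (R + Q * (R + t)) + (t + j * (R + t)) ≡ (suc Q + j) * (R + t)
  expand = solve-∀
  m'≡t+jn : m' ≡ t + j * n
  m'≡t+jn = +-cancelˡ-≡ m m' (t + j * n) (begin
    m + m'                        ≡⟨ m+m'≡kn ⟩
    k * n                         ≡⟨ cong₂ _*_ k≡ n≡ ⟩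
    (suc Q + j) * (R + t)         ≡⟨ expand R t Q j ⟨
    (R + Q * (R + t)) + (t + j * (R + t)) ≡⟨ cong (λ x → (R + Q * x) + (t + j * x)) n≡ ⟨
    (R + Q * n) + (t + j * n)     ≡⟨ cong (_+ (t + j * n)) m≡r ⟨
    m + (t + j * n)               ∎)

+[m+n]-+n≡+m : ∀ m n → + (m + n) ℤ.- + n ≡ + m
+[m+n]-+n≡+m m n = trans (ℤP.m-n≡m⊖n (m + n) n) (trans (ℤP.⊖-≥ (m≤n+m n m)) (cong +_ (m+n∸n≡m m n)))

-- Positions of the pairs (a, b)

rangeSize : ℤ → ℕ
rangeSize k = if does (0ℤ ℤ.≤? k) then suc ∣ k ∣ else 0

rangeSize-pred : ∀ t → rangeSize (ℤ.pred (+ t)) ≡ t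
rangeSize-pred zero    = refl
rangeSize-pred (suc t) = refl

map-suc-upTo-suc : ∀ n → map suc (upTo (suc n)) ≡ map suc (upTo n) ∷ʳ suc n
map-suc-upTo-suc n = begin
  map suc (upTo (suc n))     ≡⟨ map-upTo suc (suc n) ⟩
  applyUpTo suc (suc n)      ≡⟨ applyUpTo-∷ʳ suc n ⟨
  applyUpTo suc n ∷ʳ suc n   ≡⟨ cong (_∷ʳ suc n) (map-upTo suc n) ⟨
  map suc (upTo n) ∷ʳ suc n  ∎
  where open ≡-Reasoning

module _ (p q : ℕ) .{{_ : NonZero q}} where

  blockSize : ℕ → ℕ
  blockSize b = rangeSize (kk p q b)

  pairsUpTo : ℕ → List (ℕ × ℕ)
  pairsUpTo n = concatMap (pairsFor p q) (map suc (upTo n))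

  record IsIndexPair (n b a : ℕ) : Set where
    constructor indexPair
    field
      1≤b    : 1 ≤ b
      b≤n    : b ≤ n
      a<size : a < blockSize b

  κ-suc : ∀ n → κ p q (suc n) ≡ κ p q n + blockSize (suc n)
  κ-suc n = begin
    sum (map blockSize (map suc (upTo (suc n))))   ≡⟨ cong (sum ∘ map blockSize) (map-suc-upTo-suc n) ⟩
    sum (map blockSize (bs ∷ʳ suc n))              ≡⟨ cong sum (map-++ blockSize bs _) ⟩
    sum (map blockSize bs ∷ʳ blockSize (suc n))    ≡⟨ sum-++ (map blockSize bs) _ ⟩
    κ p q n + (blockSize (suc n) + 0)              ≡⟨ cong (_+_ (κ p q n)) (+-identityʳ _) ⟩
    κ p q n + blockSize (suc n)                    ∎
    where
    open ≡-Reasoning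
    bs = map suc (upTo n)

  κ≡∑ : ∀ n → κ p q n ≡ ∑ n blockSize
  κ≡∑ zero    = refl
  κ≡∑ (suc n) = trans (κ-suc n) (cong (_+ blockSize (suc n)) (κ≡∑ n))

  κ-pred : ∀ {b} → 1 ≤ b → κ p q b ≡ κ p q (b ∸ 1) + blockSize b
  κ-pred {suc b} _ = κ-suc b

  κ-mono : ∀ {m n} → m ≤ n → κ p q m ≤ κ p q n
  κ-mono {n = zero}  z≤n = ≤-refl
  κ-mono {n = suc n} m≤1+n with m≤n⇒m<n∨m≡n m≤1+n
  ... | inj₂ refl      = ≤-refl
  ... | inj₁ (s≤s m≤n) = ≤-trans (κ-mono m≤n) (subst (κ p q n ≤_) (sym (κ-suc n)) (m≤m+n _ _))

  pairsUpTo-suc : ∀ n → pairsUpTo (suc n) ≡ pairsUpTo n ++ pairsFor p q (suc n)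
  pairsUpTo-suc n = begin
    concat (map (pairsFor p q) (map suc (upTo (suc n))))  ≡⟨ cong (concat ∘ map (pairsFor p q)) (map-suc-upTo-suc n) ⟩
    concat (map (pairsFor p q) (bs ∷ʳ suc n))             ≡⟨ cong concat (map-++ (pairsFor p q) bs _) ⟩
    concat (map (pairsFor p q) bs ∷ʳ pairsFor p q (suc n)) ≡⟨ concat-++ (map (pairsFor p q) bs) _ ⟨
    pairsUpTo n ++ (pairsFor p q (suc n) ++ [])           ≡⟨ cong (pairsUpTo n ++_) (++-identityʳ _) ⟩
    pairsUpTo n ++ pairsFor p q (suc n)                   ∎
    where
    open ≡-Reasoning
    bs = map suc (upTo n)

  length-pairsFor : ∀ b → length (pairsFor p q b) ≡ blockSize b
  length-pairsFor b with does (0ℤ ℤ.≤? kk p q b)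
  ... | true  = trans (length-map _ (upTo (suc ∣ kk p q b ∣))) (length-upTo _)
  ... | false = refl

  nth-pairsFor : ∀ {b a} d → a < blockSize b → nth (pairsFor p q b) a d ≡ (a , b)
  nth-pairsFor {b} {a} d a<size with does (0ℤ ℤ.≤? kk p q b)
  ... | true  =
    trans (cong (λ xs → nth xs a d) (map-upTo (_, b) (suc ∣ kk p q b ∣))) (nth-applyUpTo (_, b) d a<size)
  ... | false = ⊥-elim (n≮0 a<size)

  length-pairsUpTo : ∀ n → length (pairsUpTo n) ≡ κ p q n
  length-pairsUpTo zero    = refl
  length-pairsUpTo (suc n) = begin
    length (pairsUpTo (suc n))
      ≡⟨ cong length (pairsUpTo-suc n) ⟩
    length (pairsUpTo n ++ pairsFor p q (suc n))
      ≡⟨ length-++ (pairsUpTo n) ⟩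
    length (pairsUpTo n) + length (pairsFor p q (suc n))
      ≡⟨ cong₂ _+_ (length-pairsUpTo n) (length-pairsFor (suc n)) ⟩
    κ p q n + blockSize (suc n)
      ≡⟨ κ-suc n ⟨
    κ p q (suc n)
      ∎
    where open ≡-Reasoning

  nth-pairsUpTo : ∀ {n b a} d → IsIndexPair n b a →
    nth (pairsUpTo n) (κ p q (b ∸ 1) + a) d ≡ (a , b)
  nth-pairsUpTo {zero} d (indexPair (s≤s _) () _)
  nth-pairsUpTo {suc n} {b} {a} d (indexPair 1≤b b≤1+n a<size) with m≤n⇒m<n∨m≡n b≤1+n
  ... | inj₂ refl = begin
    nth (pairsUpTo (suc n)) (κ p q n + a) d
      ≡⟨ cong (λ xs → nth xs (κ p q n + a) d) (pairsUpTo-suc n) ⟩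
    nth (pairsUpTo n ++ pairsFor p q b) (κ p q n + a) d
      ≡⟨ cong (λ k → nth (pairsUpTo n ++ pairsFor p q b) (k + a) d) (length-pairsUpTo n) ⟨
    nth (pairsUpTo n ++ pairsFor p q b) (length (pairsUpTo n) + a) d
      ≡⟨ nth-++ʳ (pairsUpTo n) _ a d ⟩
    nth (pairsFor p q b) a d
      ≡⟨ nth-pairsFor d a<size ⟩
    (a , b)
      ∎
    where open ≡-Reasoning
  ... | inj₁ (s≤s b≤n) = begin
    nth (pairsUpTo (suc n)) j d                    ≡⟨ cong (λ xs → nth xs j d) (pairsUpTo-suc n) ⟩
    nth (pairsUpTo n ++ pairsFor p q (suc n)) j d  ≡⟨ nth-++ˡ (pairsUpTo n) _ d j<length ⟩
    nth (pairsUpTo n) j d                          ≡⟨ nth-pairsUpTo d (indexPair 1≤b b≤n a<size) ⟩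
    (a , b)                                        ∎
    where
    open ≡-Reasoning
    j = κ p q (b ∸ 1) + a
    j<κb : j < κ p q b
    j<κb = subst (j <_) (sym (κ-pred 1≤b)) (+-monoʳ-< (κ p q (b ∸ 1)) a<size)
    j<length : j < length (pairsUpTo n)
    j<length = subst (j <_) (sym (length-pairsUpTo n)) (<-≤-trans j<κb (κ-mono b≤n))

  <κ⇒indexPair : ∀ n {j} → j < κ p q n → ∃₂ λ b a → IsIndexPair n b a × j ≡ κ p q (b ∸ 1) + a
  <κ⇒indexPair (suc n) {j} j<κ with j <? κ p q n
  ... | yes j<κn with <κ⇒indexPair n j<κn
  ...   | b , a , indexPair 1≤b b≤n a<size , j≡ = b , a , indexPair 1≤b (m≤n⇒m≤1+n b≤n) a<size , j≡
  <κ⇒indexPair (suc n) {j} j<κ | no j≮κn = suc n , j ∸ κ p q n , ip , sym (m+[n∸m]≡n κn≤j)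
    where
    κn≤j = ≮⇒≥ j≮κn
    ip : IsIndexPair (suc n) (suc n) (j ∸ κ p q n)
    ip = record
      { 1≤b    = s≤s z≤n
      ; b≤n    = ≤-refl
      ; a<size = +-cancelˡ-< (κ p q n) _ _ (subst₂ _<_ (sym (m+[n∸m]≡n κn≤j)) (κ-suc n) j<κ) }

module _ (p q : ℕ) .{{_ : NonZero q}} (q∤pb : ∀ b → 1 ≤ b → b < q → (p * b) % q ≢ 0) where

  kk≡pred : ∀ {b} → 1 ≤ b → b < q → kk p q b ≡ ℤ.pred (+ (p * b / q))
  kk≡pred {b} 1≤b b<q = [m-n-1]/ℕn≡m/n-1 (p * b) q (q∤pb b 1≤b b<q)

  blockSize≡ : ∀ {b} → 1 ≤ b → b < q → blockSize p q b ≡ p * b / q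
  blockSize≡ 1≤b b<q = trans (cong rangeSize (kk≡pred 1≤b b<q)) (rangeSize-pred _)

  blockSize-complement : ∀ {b} → 1 ≤ b → b < q → blockSize p q b + blockSize p q (q ∸ b) ≡ p ∸ 1
  blockSize-complement {b} 1≤b b<q = begin
    blockSize p q b + blockSize p q (q ∸ b)
      ≡⟨ cong₂ _+_ (blockSize≡ 1≤b b<q) (blockSize≡ (m<n⇒0<n∸m b<q) (∸-monoʳ-< 1≤b (<⇒≤ b<q))) ⟩
    p * b / q + p * (q ∸ b) / q
      ≡⟨ m/n+m'/n≡k-1 (p * b) (p * (q ∸ b)) p q (q∤pb b 1≤b b<q) pb+p[q-b]≡pq ⟩
    p ∸ 1
      ∎
    where
    open ≡-Reasoning
    pb+p[q-b]≡pq : p * b + p * (q ∸ b) ≡ p * q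
    pb+p[q-b]≡pq = trans (sym (*-distribˡ-+ p b (q ∸ b))) (cong (p *_) (m+[n∸m]≡n (<⇒≤ b<q)))

  genus≡κ : genus p q ≡ κ p q (q ∸ 1)
  genus≡κ = begin
    (p ∸ 1) * (q ∸ 1) / 2   ≡⟨ /-congˡ [p-1][q-1]≡2κ ⟩
    κ p q (q ∸ 1) * 2 / 2   ≡⟨ m*n/n≡m (κ p q (q ∸ 1)) 2 ⟩
    κ p q (q ∸ 1)           ∎
    where
    open ≡-Reasoning
    pairing : ∀ b → 1 ≤ b → b ≤ q ∸ 1 → blockSize p q b + blockSize p q (suc (q ∸ 1) ∸ b) ≡ p ∸ 1
    pairing b 1≤b b≤q-1 =
      subst (λ n → blockSize p q b + blockSize p q (n ∸ b) ≡ p ∸ 1) (sym (suc-pred q))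
        (blockSize-complement 1≤b (subst (b <_) (suc-pred q) (s≤s b≤q-1)))
    [p-1][q-1]≡2κ : (p ∸ 1) * (q ∸ 1) ≡ κ p q (q ∸ 1) * 2
    [p-1][q-1]≡2κ = begin
      (p ∸ 1) * (q ∸ 1)               ≡⟨ *-comm (p ∸ 1) (q ∸ 1) ⟩
      (q ∸ 1) * (p ∸ 1)               ≡⟨ ∑-pairing (q ∸ 1) (blockSize p q) (p ∸ 1) pairing ⟨
      ∑ (q ∸ 1) (blockSize p q) * 2   ≡⟨ cong (_* 2) (κ≡∑ p q (q ∸ 1)) ⟨
      κ p q (q ∸ 1) * 2               ∎

-- The Galois action on the blocks

exponent : ℕ → ℕ → ℕ → ℕ → ℤ
exponent p q a b = + (q * suc a) ℤ.- + (p * b)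

exponent≡ : ∀ p q a b → exponent p q a b ≡ + q ℤ.* + suc a ℤ.- + p ℤ.* + b
exponent≡ p q a b = cong₂ ℤ._-_ (ℤP.pos-* q (suc a)) (ℤP.pos-* p b)

-- Modulo pq: u q (a+1) ≡ q c (a+1) ≡ q (s+1) because p ∣ c (a+1) - (s+1), and u p b ≡ p b.
σ-exponent : ∀ p q c u a b s m → c * suc a ≡ suc s + m * p →
  + (p * q) ℤᵘ.∣ (+ u ℤ.* + q ℤ.- + (q * c)) → + (p * q) ℤᵘ.∣ (+ u ℤ.* + p ℤ.- + p) →
  + (p * q) ℤᵘ.∣ (+ u ℤ.* exponent p q a b ℤ.- exponent p q s b)
σ-exponent p q c u a b s m c[1+a]≡ pq∣uq-qc pq∣up-p =
  ∣⇒∣ᵤ (subst (+ (p * q) ∣ℤ_) (sym expand) combination)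
  where
  N = + (p * q)
  A = + suc a
  B = + b
  S≡ : + suc s ≡ + c ℤ.* A ℤ.- + m ℤ.* + p
  S≡ = begin
    + suc s                            ≡⟨ +[m+n]-+n≡+m (suc s) (m * p) ⟨
    + (suc s + m * p) ℤ.- + (m * p)    ≡⟨ cong₂ (λ x y → + x ℤ.- y) (sym c[1+a]≡) (ℤP.pos-* m p) ⟩
    + (c * suc a) ℤ.- + m ℤ.* + p      ≡⟨ cong (ℤ._- + m ℤ.* + p) (ℤP.pos-* c (suc a)) ⟩
    + c ℤ.* A ℤ.- + m ℤ.* + p          ∎
    where open ≡-Reasoning
  identity : ∀ U A B P Q C M →
    U ℤ.* (Q ℤ.* A ℤ.- P ℤ.* B) ℤ.- (Q ℤ.* (C ℤ.* A ℤ.- M ℤ.* P) ℤ.- P ℤ.* B)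
      ≡ A ℤ.* (U ℤ.* Q ℤ.- Q ℤ.* C) ℤ.- B ℤ.* (U ℤ.* P ℤ.- P) ℤ.+ M ℤ.* (P ℤ.* Q)
  identity = ℤ-Solver.solve-∀
  expand : + u ℤ.* exponent p q a b ℤ.- exponent p q s b
         ≡ A ℤ.* (+ u ℤ.* + q ℤ.- + (q * c)) ℤ.- B ℤ.* (+ u ℤ.* + p ℤ.- + p) ℤ.+ + m ℤ.* N
  expand = begin
    + u ℤ.* exponent p q a b ℤ.- exponent p q s b
      ≡⟨ cong₂ (λ x y → + u ℤ.* x ℤ.- y) (exponent≡ p q a b) (exponent≡ p q s b) ⟩
    + u ℤ.* (+ q ℤ.* A ℤ.- + p ℤ.* B) ℤ.- (+ q ℤ.* + suc s ℤ.- + p ℤ.* B)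
      ≡⟨ cong (λ x → + u ℤ.* (+ q ℤ.* A ℤ.- + p ℤ.* B) ℤ.- (+ q ℤ.* x ℤ.- + p ℤ.* B)) S≡ ⟩
    + u ℤ.* (+ q ℤ.* A ℤ.- + p ℤ.* B) ℤ.- (+ q ℤ.* (+ c ℤ.* A ℤ.- + m ℤ.* + p) ℤ.- + p ℤ.* B)
      ≡⟨ identity (+ u) A B (+ p) (+ q) (+ c) (+ m) ⟩
    A ℤ.* (+ u ℤ.* + q ℤ.- + q ℤ.* + c) ℤ.- B ℤ.* (+ u ℤ.* + p ℤ.- + p) ℤ.+ + m ℤ.* (+ p ℤ.* + q)
      ≡⟨ cong₂ (λ x y → A ℤ.* (+ u ℤ.* + q ℤ.- x) ℤ.- B ℤ.* (+ u ℤ.* + p ℤ.- + p) ℤ.+ + m ℤ.* y)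
               (ℤP.pos-* q c) (ℤP.pos-* p q) ⟨
    A ℤ.* (+ u ℤ.* + q ℤ.- + (q * c)) ℤ.- B ℤ.* (+ u ℤ.* + p ℤ.- + p) ℤ.+ + m ℤ.* N
      ∎
    where open ≡-Reasoning
  combination : N ∣ℤ A ℤ.* (+ u ℤ.* + q ℤ.- + (q * c)) ℤ.- B ℤ.* (+ u ℤ.* + p ℤ.- + p) ℤ.+ + m ℤ.* N
  combination = ∣m∣n⇒∣m+n
    (∣m∣n⇒∣m-n (∣n⇒∣m*n A (∣ᵤ⇒∣ {N} {+ u ℤ.* + q ℤ.- + (q * c)} pq∣uq-qc))
                (∣n⇒∣m*n B (∣ᵤ⇒∣ {N} {+ u ℤ.* + p ℤ.- + p} pq∣up-p)))
    (∣n⇒∣m*n (+ m) ∣-refl)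

exponent-complement : ∀ {p q a a' b b'} → suc a' + suc a ≡ p → b' + b ≡ q →
  exponent p q a' b' ≡ ℤ.- exponent p q a b
exponent-complement {p} {q} {a} {a'} {b} {b'} a'+a≡ b'+b≡ = begin
  exponent p q a' b'                                   ≡⟨ exponent≡ p q a' b' ⟩
  + q ℤ.* + suc a' ℤ.- + p ℤ.* + b'                    ≡⟨ cong₂ (λ x y → + q ℤ.* x ℤ.- + p ℤ.* y) A'≡ B'≡ ⟩
  + q ℤ.* (+ p ℤ.- + suc a) ℤ.- + p ℤ.* (+ q ℤ.- + b)  ≡⟨ identity (+ q) (+ p) (+ suc a) (+ b) ⟩
  ℤ.- (+ q ℤ.* + suc a ℤ.- + p ℤ.* + b)                ≡⟨ cong ℤ.-_ (exponent≡ p q a b) ⟨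
  ℤ.- exponent p q a b                                 ∎
  where
  open ≡-Reasoning
  A'≡ : + suc a' ≡ + p ℤ.- + suc a
  A'≡ = trans (sym (+[m+n]-+n≡+m (suc a') (suc a))) (cong (λ x → + x ℤ.- + suc a) a'+a≡)
  B'≡ : + b' ≡ + q ℤ.- + b
  B'≡ = trans (sym (+[m+n]-+n≡+m b' b)) (cong (λ x → + x ℤ.- + b) b'+b≡)
  identity : ∀ Q P S B → Q ℤ.* (P ℤ.- S) ℤ.- P ℤ.* (Q ℤ.- B) ≡ ℤ.- (Q ℤ.* S ℤ.- P ℤ.* B)
  identity = ℤ-Solver.solve-∀

σ-Zpow : ∀ N u e e' → + N ℤᵘ.∣ (+ u ℤ.* e ℤ.- e') →
  ∀ x y → EntEq N (σE u (Zpow e x y)) (Zpow e' x y)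
σ-Zpow N u e e' N∣ue-e' zero       zero       = N∣ue-e'
σ-Zpow N u e e' N∣ue-e' zero       (suc zero) = tt
σ-Zpow N u e e' N∣ue-e' (suc zero) zero       = tt
σ-Zpow N u e e' N∣ue-e' (suc zero) (suc zero) =
  ∣⇒∣ᵤ (subst (+ N ∣ℤ_) (negate (+ u) e e') (∣m⇒∣-m (∣ᵤ⇒∣ N∣ue-e')))
  where
  negate : ∀ u e e' → ℤ.- (u ℤ.* e ℤ.- e') ≡ u ℤ.* ℤ.- e ℤ.- ℤ.- e'
  negate = ℤ-Solver.solve-∀

conjM2-Zpow-neg : ∀ e x y → conjM2 (Zpow (ℤ.- e)) x y ≡ Zpow e x y
conjM2-Zpow-neg e zero       zero       = cong ζ^ (ℤP.neg-involutive e)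
conjM2-Zpow-neg e zero       (suc zero) = refl
conjM2-Zpow-neg e (suc zero) zero       = refl
conjM2-Zpow-neg e (suc zero) (suc zero) = cong (ζ^ ∘ ℤ.-_) (ℤP.neg-involutive e)

p*b%q≢0 : ∀ {p q b} .{{_ : NonZero q}} → Prime p → Prime q → p ≢ q → 1 ≤ b → b < q → (p * b) % q ≢ 0
p*b%q≢0 {p} {q} {b} p-prime q-prime p≢q 1≤b b<q pb%q≡0
  with euclidsLemma p b q-prime (m%n≡0⇒n∣m (p * b) q pb%q≡0)
... | inj₂ q∣b = <⇒≱ b<q (∣⇒≤ {{>-nonZero 1≤b}} q∣b)
... | inj₁ q∣p with prime⇒irreducible p-prime q∣p
...   | inj₁ q≡1 = nonTrivial⇒≢1 {{prime⇒nonTrivial q-prime}} q≡1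
...   | inj₂ q≡p = p≢q (sym q≡p)

odd-prime⇒2<p : ∀ {p} → Prime p → p ≢ 2 → 2 < p
odd-prime⇒2<p {p} p-prime p≢2 with m≤n⇒m<n∨m≡n (nonTrivial⇒n>1 p {{prime⇒nonTrivial p-prime}})
... | inj₁ 2<p = 2<p
... | inj₂ 2≡p = ⊥-elim (p≢2 (sym 2≡p))

-- Otherwise no power of c would be 2 modulo p.
generator⇒∤ : ∀ {p c} .{{_ : NonZero p}} → 2 < p → IsGenerator p c → ¬ p ∣ c
generator⇒∤ {p} {c} 2<p c-generates p∣c with c-generates 2 (s≤s z≤n) 2<p
... | zero  , 1%p≡2 = 1≢2 (trans (sym (m<n⇒m%n≡m (<-trans (s≤s (s≤s z≤n)) 2<p))) 1%p≡2)
  where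
  1≢2 : 1 ≢ 2
  1≢2 ()
... | suc n , c^[1+n]%p≡2 =
  0≢2 (trans (sym (n∣m⇒m%n≡0 (c ^ suc n) p (∣-trans p∣c (m∣m*n (c ^ n))))) c^[1+n]%p≡2)
  where
  0≢2 : 0 ≢ 2
  0≢2 ()

c*[1+a]%p≢0 : ∀ {p c a} .{{_ : NonZero p}} → Prime p → 2 < p → IsGenerator p c →
  suc a < p → (c * suc a) % p ≢ 0
c*[1+a]%p≢0 {p} {c} {a} p-prime 2<p c-generates 1+a<p c[1+a]%p≡0
  with euclidsLemma c (suc a) p-prime (m%n≡0⇒n∣m (c * suc a) p c[1+a]%p≡0)
... | inj₁ p∣c   = generator⇒∤ 2<p c-generates p∣c
... | inj₂ p∣1+a = <⇒≱ 1+a<p (∣⇒≤ p∣1+a)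

blockDiag-σ≈ : ∀ N u n (A B : ℕ → Mat2) →
  (∀ i → 1 ≤ i → i ≤ n → ∀ x y → EntEq N (σE u (A i x y)) (B i x y)) →
  MatEq N (2 * n) (σMat u (blockDiag A)) (blockDiag B)
blockDiag-σ≈ N u n A B A≈B r s r<2n _ with r / 2 ℕ.≡ᵇ s / 2
... | true  = A≈B (suc (r / 2)) (s≤s z≤n) r/2<n (r mod 2) (s mod 2)
  where
  r/2<n : r / 2 < n
  r/2<n = m<n*o⇒m/o<n (subst (r <_) (*-comm 2 n) r<2n)
... | false = tt

-- The blocks of ^{σ_p} α

IndicesValid : (p q c : ℕ) .{{_ : NonZero p}} .{{_ : NonZero q}} → ℕ → Set
IndicesValid p q c i =
  (0ℤ ℤ.≤ sIdx p q c i → sIdx p q c i ℤ.≤ kk p q (bIdx p q i) →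
    (+ 1 ℤ.≤ ι₁ p q c i) × (ι₁ p q c i ℤ.≤ + genus p q))
  × (kk p q (bIdx p q i) ℤ.< sIdx p q c i →
    (+ 1 ℤ.≤ ι₂ p q c i) × (ι₂ p q c i ℤ.≤ + genus p q))

BlockAgrees : (p q c u : ℕ) .{{_ : NonZero p}} .{{_ : NonZero q}} → ℕ → Set
BlockAgrees p q c u i = ∀ x y → EntEq (p * q) (σE u (αBlock p q i x y)) (βBlock p q c i x y)

module _ (p q c u : ℕ) .{{_ : NonZero p}} .{{_ : NonZero q}}
  (q∤pb : ∀ b → 1 ≤ b → b < q → (p * b) % q ≢ 0)
  (p∤c[1+a] : ∀ a → suc a < p → (c * suc a) % p ≢ 0)
  (σζ^q : EntEq (p * q) (σE u (ζ^ (+ q))) (ζ^ (+ (q * c))))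
  (σζ^p : EntEq (p * q) (σE u (ζ^ (+ p))) (ζ^ (+ p))) where

  blockIndex : ℕ → ℕ → ℕ
  blockIndex b a = κ p q (b ∸ 1) + a + 1

  pairAt-blockIndex : ∀ {b a} → IsIndexPair p q (q ∸ 1) b a → pairAt p q (blockIndex b a) ≡ (a , b)
  pairAt-blockIndex {b} {a} ip =
    trans (cong (λ j → nth (pairs p q) j (0 , 0)) (m+n∸n≡m (κ p q (b ∸ 1) + a) 1))
          (nth-pairsUpTo p q (0 , 0) ip)

  blockIndex-bounds : ∀ {b a} → IsIndexPair p q (q ∸ 1) b a →
    (+ 1 ℤ.≤ + blockIndex b a) × (+ blockIndex b a ℤ.≤ + genus p q)
  blockIndex-bounds {b} {a} (indexPair 1≤b b≤q-1 a<size) = +≤+ (m≤n+m 1 _) , +≤+ (begin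
    κ p q (b ∸ 1) + a + 1          ≡⟨ +-comm (κ p q (b ∸ 1) + a) 1 ⟩
    suc (κ p q (b ∸ 1) + a)        ≡⟨ +-suc (κ p q (b ∸ 1)) a ⟨
    κ p q (b ∸ 1) + suc a          ≤⟨ +-monoʳ-≤ (κ p q (b ∸ 1)) a<size ⟩
    κ p q (b ∸ 1) + blockSize p q b ≡⟨ κ-pred p q 1≤b ⟨
    κ p q b                        ≤⟨ κ-mono p q b≤q-1 ⟩
    κ p q (q ∸ 1)                  ≡⟨ genus≡κ p q q∤pb ⟨
    genus p q                      ∎)
    where open ≤-Reasoning

  αBlock-pairAt : ∀ {j a b} → pairAt p q j ≡ (a , b) → αBlock p q j ≡ Zpow (exponent p q a b)
  αBlock-pairAt = cong (λ (a , b) → Zpow (exponent p q a b))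

  βBlock-inside : ∀ i → 0ℤ ℤ.≤ sIdx p q c i → sIdx p q c i ℤ.≤ kk p q (bIdx p q i) →
    βBlock p q c i ≡ αBlock p q ∣ ι₁ p q c i ∣
  βBlock-inside i 0≤s s≤k
    rewrite dec-true (0ℤ ℤ.≤? sIdx p q c i) 0≤s
          | dec-true (sIdx p q c i ℤ.≤? kk p q (bIdx p q i)) s≤k = refl

  βBlock-outside : ∀ i → 0ℤ ℤ.≤ sIdx p q c i → ¬ sIdx p q c i ℤ.≤ kk p q (bIdx p q i) →
    βBlock p q c i ≡ conjM2 (αBlock p q ∣ ι₂ p q c i ∣)
  βBlock-outside i 0≤s s≰k
    rewrite dec-true (0ℤ ℤ.≤? sIdx p q c i) 0≤s
          | dec-false (sIdx p q c i ℤ.≤? kk p q (bIdx p q i)) s≰k = refl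

  module Block {i b a s m : ℕ} (ip : IsIndexPair p q (q ∸ 1) b a) (i↦ab : pairAt p q i ≡ (a , b))
               (c[1+a]%p≡ : (c * suc a) % p ≡ suc s) (c[1+a]≡ : c * suc a ≡ suc s + m * p) where

    open IsIndexPair ip

    b<q : b < q
    b<q = subst (b <_) (suc-pred q) (s≤s b≤n)

    T : ℕ
    T = p * b / q

    sIdx≡ : sIdx p q c i ≡ + s
    sIdx≡ = trans (cong (λ (a , _) → + ((c * suc a) % p) ℤ.- + 1) i↦ab)
                  (cong (λ r → + r ℤ.- + 1) c[1+a]%p≡)

    kk≡ : kk p q (bIdx p q i) ≡ ℤ.pred (+ T)
    kk≡ = trans (cong (kk p q ∘ proj₂) i↦ab) (kk≡pred p q q∤pb 1≤b b<q)

    0≤sIdx : 0ℤ ℤ.≤ sIdx p q c i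
    0≤sIdx = subst (0ℤ ℤ.≤_) (sym sIdx≡) (+≤+ z≤n)

    σαBlock : ∀ x y → EntEq (p * q) (σE u (αBlock p q i x y)) (Zpow (exponent p q s b) x y)
    σαBlock = subst (λ B → ∀ x y → EntEq (p * q) (σE u (B x y)) (Zpow (exponent p q s b) x y))
      (sym (αBlock-pairAt {i} i↦ab))
      (σ-Zpow (p * q) u _ _ (σ-exponent p q c u a b s m c[1+a]≡ σζ^q σζ^p))

    agrees : (∀ x y → βBlock p q c i x y ≡ Zpow (exponent p q s b) x y) → BlockAgrees p q c u i
    agrees β≡ x y = subst (EntEq (p * q) (σE u (αBlock p q i x y))) (sym (β≡ x y)) (σαBlock x y)

    inside : s < T → IndicesValid p q c i × BlockAgrees p q c u i
    inside s<T = ((λ _ _ → bounds) , λ k<s → ⊥-elim (ℤP.≤⇒≯ s≤k k<s)) , agrees β≡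
      where
      sip : IsIndexPair p q (q ∸ 1) b s
      sip = indexPair 1≤b b≤n (subst (s <_) (sym (blockSize≡ p q q∤pb 1≤b b<q)) s<T)
      ι₁≡ : ι₁ p q c i ≡ + blockIndex b s
      ι₁≡ = cong₂ (λ b s → + κ p q (b ∸ 1) ℤ.+ s ℤ.+ + 1) (cong proj₂ i↦ab) sIdx≡
      bounds : (+ 1 ℤ.≤ ι₁ p q c i) × (ι₁ p q c i ℤ.≤ + genus p q)
      bounds = subst (λ ι → (+ 1 ℤ.≤ ι) × (ι ℤ.≤ + genus p q)) (sym ι₁≡) (blockIndex-bounds sip)
      s≤k : sIdx p q c i ℤ.≤ kk p q (bIdx p q i)
      s≤k = subst₂ ℤ._≤_ (sym sIdx≡) (sym kk≡) (ℤP.i<j⇒i≤pred[j] (+<+ s<T))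
      β≡ : ∀ x y → βBlock p q c i x y ≡ Zpow (exponent p q s b) x y
      β≡ x y = cong (λ B → B x y) (begin
        βBlock p q c i                ≡⟨ βBlock-inside i 0≤sIdx s≤k ⟩
        αBlock p q ∣ ι₁ p q c i ∣     ≡⟨ cong (αBlock p q ∘ ∣_∣) ι₁≡ ⟩
        αBlock p q (blockIndex b s)   ≡⟨ αBlock-pairAt {blockIndex b s} (pairAt-blockIndex sip) ⟩
        Zpow (exponent p q s b)       ∎)
        where open ≡-Reasoning

    outside : T ≤ s → IndicesValid p q c i × BlockAgrees p q c u i
    outside T≤s = ((λ _ s≤k → ⊥-elim (s≰k s≤k)) , λ _ → bounds) , agrees β≡
      where
      b' = q ∸ b
      a' = p ∸ suc (suc s)
      b'+b≡q : b' + b ≡ q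
      b'+b≡q = m∸n+n≡m (<⇒≤ b<q)
      a'+s≡p : suc a' + suc s ≡ p
      a'+s≡p = trans (sym (+-suc a' (suc s)))
                     (m∸n+n≡m (subst (_< p) c[1+a]%p≡ (m%n<n (c * suc a) p)))
      1≤b' : 1 ≤ b'
      1≤b' = m<n⇒0<n∸m b<q
      sip : IsIndexPair p q (q ∸ 1) b' a'
      sip = indexPair 1≤b' (∸-monoʳ-≤ q 1≤b) (+-cancelʳ-≤ (suc s) (suc a') (blockSize p q b') (begin
        suc a' + suc s                           ≡⟨ trans a'+s≡p (sym (suc-pred p)) ⟩
        suc (p ∸ 1)                              ≡⟨ cong suc (blockSize-complement p q q∤pb 1≤b b<q) ⟨
        suc (blockSize p q b + blockSize p q b') ≡⟨ cong suc (+-comm (blockSize p q b) _) ⟩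
        suc (blockSize p q b' + blockSize p q b) ≡⟨ +-suc (blockSize p q b') _ ⟨
        blockSize p q b' + suc (blockSize p q b) ≤⟨ +-monoʳ-≤ (blockSize p q b') (s≤s size≤s) ⟩
        blockSize p q b' + suc s                 ∎))
        where
        open ≤-Reasoning
        size≤s : blockSize p q b ≤ s
        size≤s = subst (_≤ s) (sym (blockSize≡ p q q∤pb 1≤b b<q)) T≤s
      regroup : ∀ K a s → K + (suc a + suc s) ≡ (K + a + 1) + (s + 1)
      regroup = solve-∀
      ι₂≡ : ι₂ p q c i ≡ + blockIndex b' a'
      ι₂≡ = begin
        ι₂ p q c i
          ≡⟨ cong₂ (λ b s → + κ p q ((q ∸ b) ∸ 1) ℤ.+ + p ℤ.- (s ℤ.+ + 1)) (cong proj₂ i↦ab) sIdx≡ ⟩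
        + (κ p q (b' ∸ 1) + p) ℤ.- + (s + 1)
          ≡⟨ cong (λ x → + (κ p q (b' ∸ 1) + x) ℤ.- + (s + 1)) a'+s≡p ⟨
        + (κ p q (b' ∸ 1) + (suc a' + suc s)) ℤ.- + (s + 1)
          ≡⟨ cong (λ x → + x ℤ.- + (s + 1)) (regroup (κ p q (b' ∸ 1)) a' s) ⟩
        + (blockIndex b' a' + (s + 1)) ℤ.- + (s + 1)
          ≡⟨ +[m+n]-+n≡+m (blockIndex b' a') (s + 1) ⟩
        + blockIndex b' a'
          ∎
        where open ≡-Reasoning
      bounds : (+ 1 ℤ.≤ ι₂ p q c i) × (ι₂ p q c i ℤ.≤ + genus p q)
      bounds = subst (λ ι → (+ 1 ℤ.≤ ι) × (ι ℤ.≤ + genus p q)) (sym ι₂≡) (blockIndex-bounds sip)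
      s≰k : ¬ sIdx p q c i ℤ.≤ kk p q (bIdx p q i)
      s≰k s≤k = <⇒≱ (ℤP.drop‿+<+ (ℤP.i≤pred[j]⇒i<j (subst₂ ℤ._≤_ sIdx≡ kk≡ s≤k))) T≤s
      β≡ : ∀ x y → βBlock p q c i x y ≡ Zpow (exponent p q s b) x y
      β≡ x y = trans (cong (λ B → B x y) (begin
        βBlock p q c i
          ≡⟨ βBlock-outside i 0≤sIdx s≰k ⟩
        conjM2 (αBlock p q ∣ ι₂ p q c i ∣)
          ≡⟨ cong (conjM2 ∘ αBlock p q ∘ ∣_∣) ι₂≡ ⟩
        conjM2 (αBlock p q (blockIndex b' a'))
          ≡⟨ cong conjM2 (αBlock-pairAt {blockIndex b' a'} (pairAt-blockIndex sip)) ⟩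
        conjM2 (Zpow (exponent p q a' b'))
          ≡⟨ cong (conjM2 ∘ Zpow) (exponent-complement a'+s≡p b'+b≡q) ⟩
        conjM2 (Zpow (ℤ.- exponent p q s b))
          ∎)) (conjM2-Zpow-neg (exponent p q s b) x y)
        where open ≡-Reasoning

    valid-agrees : IndicesValid p q c i × BlockAgrees p q c u i
    valid-agrees with s <? T
    ... | yes s<T = inside s<T
    ... | no  s≮T = outside (≮⇒≥ s≮T)

  c[1+a]≡1+s+m*p : ∀ a → suc a < p → ∃₂ λ s m → (c * suc a) % p ≡ suc s × c * suc a ≡ suc s + m * p
  c[1+a]≡1+s+m*p a 1+a<p with (c * suc a) % p in r≡
  ... | zero  = ⊥-elim (p∤c[1+a] a 1+a<p r≡)
  ... | suc s = s , (c * suc a) / p , refl ,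
    trans (m≡m%n+[m/n]*n (c * suc a) p) (cong (_+ (c * suc a) / p * p) r≡)

  block-valid-agrees : ∀ i → 1 ≤ i → i ≤ genus p q → IndicesValid p q c i × BlockAgrees p q c u i
  block-valid-agrees i 1≤i i≤g with <κ⇒indexPair p q (q ∸ 1) i-1<κ
    where
    i-1<κ : i ∸ 1 < κ p q (q ∸ 1)
    i-1<κ = subst (i ∸ 1 <_) (genus≡κ p q q∤pb) (<-≤-trans (∸-monoʳ-< (s≤s z≤n) 1≤i) i≤g)
  ... | b , a , ip@(indexPair 1≤b b≤n a<size) , i-1≡ with c[1+a]≡1+s+m*p a 1+a<p
    where
    1+a<p : suc a < p
    1+a<p = ≤-<-trans (subst (a <_) (blockSize≡ p q q∤pb 1≤b b<q) a<size)
                      (m<n*o⇒m/o<n (*-monoʳ-< p b<q))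
      where b<q = subst (b <_) (suc-pred q) (s≤s b≤n)
  ... | s , m , r≡ , c[1+a]≡ = Block.valid-agrees {i} {m = m} ip i↦ab r≡ c[1+a]≡
    where
    i↦ab : pairAt p q i ≡ (a , b)
    i↦ab = trans (cong (λ j → nth (pairs p q) j (0 , 0)) i-1≡) (nth-pairsUpTo p q (0 , 0) ip)

proposition3p6 :
    (p q : ℕ) {{_ : NonZero p}} {{_ : NonZero q}} →
    Prime p → Prime q → p ≢ 2 → q ≢ 2 → p ≢ q →
    (c : ℕ) → IsGenerator p c →
    -- σ_p : ζ ↦ ζ^u, with σ_p(ζ^q) = ζ^{qc} and σ_p(ζ^p) = ζ^p
    (u : ℕ) →
    EntEq (p * q) (σE u (ζ^ (+ q))) (ζ^ (+ (q * c))) →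
    EntEq (p * q) (σE u (ζ^ (+ p))) (ζ^ (+ p)) →
    -- the indices ι₁, ι₂ used are valid block indices in {1, …, g}
    (∀ i → 1 ≤ i → i ≤ genus p q →
      (0ℤ ℤ.≤ sIdx p q c i → sIdx p q c i ℤ.≤ kk p q (bIdx p q i) →
        (+ 1 ℤ.≤ ι₁ p q c i) × (ι₁ p q c i ℤ.≤ + genus p q))
      × (kk p q (bIdx p q i) ℤ.< sIdx p q c i →
        (+ 1 ℤ.≤ ι₂ p q c i) × (ι₂ p q c i ℤ.≤ + genus p q)))
    ×
    -- ^{σ_p} α equals the block diagonal matrix with blocks βBlock
    MatEq (p * q) (2 * genus p q) (σMat u (α p q)) (β p q c)
-- The argument never needs q to be odd.
proposition3p6 p q p-prime q-prime p≢2 _ p≢q c c-generates u σζ^q σζ^p =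
  (λ i 1≤i i≤g → proj₁ (block i 1≤i i≤g)) ,
  blockDiag-σ≈ (p * q) u (genus p q) (αBlock p q) (βBlock p q c) (λ i 1≤i i≤g → proj₂ (block i 1≤i i≤g))
  where
  q∤pb : ∀ b → 1 ≤ b → b < q → (p * b) % q ≢ 0
  q∤pb _ = p*b%q≢0 p-prime q-prime p≢q
  p∤c[1+a] : ∀ a → suc a < p → (c * suc a) % p ≢ 0
  p∤c[1+a] _ = c*[1+a]%p≢0 p-prime (odd-prime⇒2<p p-prime p≢2) c-generates
  block : ∀ i → 1 ≤ i → i ≤ genus p q → IndicesValid p q c i × BlockAgrees p q c u i
  block = block-valid-agrees p q c u q∤pb p∤c[1+a] σζ^q σζ^p
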